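{- Let $n>1$ be an integer and let $G$ be a finite group having subgroups $A$, $B$ and $M$ such that (1) $|A|=|B|=|M|=nk$ and $|G|=n^3k$, where $k=|A\cap B|$; (2) $AM=\{am\mid a\in A,\ m\in M\}$ and $BM=\{bm\mid b\in B,\ m\in M\}$ are subgroups of $G$ of order $n^2k$; (3) $G=AMB$; (4) $AB\cap BA=A\cup B$. Then there is a projective plane $\pi$ of order $n$ on which $G$ acts by collineations such that the group of collineations induced by $G$ is a soft group of $\pi$; in particular $\pi$ is a soft plane.
   Context: A flag of a projective plane is an incident point–line pair. A collineation group $H$ of a finite projective plane is a soft group if $H$ fixes some flag $(\infty,L_\infty)$ and is transitive on the set of flags $(w,W)$ with $w$ not on $L_\infty$ and $\infty$ not on $W$. A projective plane is a soft plane if it admits a soft group. The action of $G$ need not be faithful. -}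

module Defs where

open import Level using (0ℓ)
open import Data.Nat using (ℕ; suc)
open import Data.Fin using (Fin)
open import Data.Fin.Properties using (any?) renaming (_≟_ to _≟F_)
open import Data.Fin.Subset using (Subset; _∈_)
open import Data.Fin.Subset.Properties using (_∈?_)
open import Data.Bool using (Bool; true)
open import Data.Vec using (tabulate)
open import Data.Product using (Σ; ∃; ∃-syntax; _×_; _,_)
open import Relation.Nullary using (¬_; does)
open import Relation.Nullary.Decidable using (_×-dec_)
open import Relation.Binary.PropositionalEquality using (_≡_)
open import Algebra.Core using (Op₁; Op₂)
open import Algebra.Structures using (IsGroup)
open import Function.Bundles using (_↔_)

-- Finite groups: a finite group of order N is presented (up to
-- isomorphism) as a group structure on Fin N with propositional equality.

record FiniteGroup (N : ℕ) : Set where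
  field
    _∙_     : Op₂ (Fin N)
    ε       : Fin N
    _⁻¹     : Op₁ (Fin N)
    isGroup : IsGroup _≡_ _∙_ ε _⁻¹

module _ {N : ℕ} (G : FiniteGroup N) where
  open FiniteGroup G

  record IsSubgroup (S : Subset N) : Set where
    field
      ε∈   : ε ∈ S
      ∙∈   : ∀ {x y} → x ∈ S → y ∈ S → (x ∙ y) ∈ S
      ⁻¹∈  : ∀ {x} → x ∈ S → (x ⁻¹) ∈ S

  _·_ : Subset N → Subset N → Subset N
  S · T = tabulate λ g →
    does (any? λ s → any? λ t → (s ∈? S) ×-dec ((t ∈? T) ×-dec ((s ∙ t) ≟F g)))

record ProjectivePlane : Set₁ where
  field
    Point : Set
    Line  : Set
    _I_   : Point → Line → Bool

  On : Point → Line → Set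
  On p l = (p I l) ≡ true

  field
    join     : ∀ p q → ¬ p ≡ q → ∃[ l ] (On p l × On q l)
    join-uniq : ∀ p q l m → ¬ p ≡ q → On p l → On q l → On p m → On q m → l ≡ m
    meet     : ∀ l m → ¬ l ≡ m → ∃[ p ] (On p l × On p m)
    meet-uniq : ∀ l m p q → ¬ l ≡ m → On p l → On p m → On q l → On q m → p ≡ q
    quadrangle : Σ (Point × Point × Point × Point) λ { (a , b , c , d) →
      (¬ a ≡ b) × (¬ a ≡ c) × (¬ a ≡ d) × (¬ b ≡ c) × (¬ b ≡ d) × (¬ c ≡ d) ×
      (∀ l → ¬ (On a l × On b l × On c l)) ×
      (∀ l → ¬ (On a l × On b l × On d l)) ×
      (∀ l → ¬ (On a l × On c l × On d l)) ×
      (∀ l → ¬ (On b l × On c l × On d l)) }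

  PointsOn : Line → Set
  PointsOn l = Σ Point λ p → On p l

-- The plane has order n: some (equivalently every) line carries exactly n+1 points.
HasOrder : ProjectivePlane → ℕ → Set
HasOrder π n = ∃[ l ] (PointsOn l ↔ Fin (suc n))
  where open ProjectivePlane π

-- An action of a finite group G on a projective plane by collineations
-- (not necessarily faithful).
record CollineationAction {N : ℕ} (G : FiniteGroup N) (π : ProjectivePlane) : Set where
  open FiniteGroup G
  open ProjectivePlane π
  field
    pt   : Fin N → Point → Point
    ln   : Fin N → Line → Line
    pt-ε : ∀ p → pt ε p ≡ p
    ln-ε : ∀ l → ln ε l ≡ l
    pt-∙ : ∀ g h p → pt (g ∙ h) p ≡ pt g (pt h p)
    ln-∙ : ∀ g h l → ln (g ∙ h) l ≡ ln g (ln h l)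
    inc  : ∀ g p l → (pt g p I ln g l) ≡ (p I l)

-- The group of collineations induced by G is a soft group: it fixes a flag
-- (∞ , L∞) and is transitive on the flags (w , W) with w ∉ L∞ and ∞ ∉ W.
-- (The induced group is the image of G, so this is phrased via G.)
IsSoftAction : ∀ {N} {G : FiniteGroup N} {π : ProjectivePlane} →
               CollineationAction G π → Set
IsSoftAction {N} {G} {π} act =
  Σ (Point × Line) λ { (∞ , L∞) →
    On ∞ L∞ ×
    (∀ g → pt g ∞ ≡ ∞) × (∀ g → ln g L∞ ≡ L∞) ×
    (∀ w W w′ W′ →
       On w W → ¬ On w L∞ → ¬ On ∞ W →
       On w′ W′ → ¬ On w′ L∞ → ¬ On ∞ W′ →
       ∃[ g ] (pt g w ≡ w′ × ln g W ≡ W′)) }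
  where
    open ProjectivePlane π
    open CollineationAction act

{-# OPTIONS --safe #-}
module Submission where

-- Points are ∞, the left cosets of BM (the points of L∞) and the left cosets of A; lines are L∞,
-- the left cosets of AM (the lines through ∞) and the left cosets of B.  A coset of A lies on the
-- coset of AM containing it and on every coset of B it meets; a coset of BM lies on the cosets of
-- B it contains.  G acts by left multiplication fixing (∞, L∞), and x′x⁻¹ carries a flag (aA, sB)
-- with aA ∩ sB ∋ x to one with a′A ∩ s′B ∋ x′.  The axioms rest on three facts about G.
-- AB ∩ BA = A ∪ B: two cosets of A share at most one coset of B.
-- AM ∩ B = A ∩ B = BM ∩ A, forced by the orders since AM·B = A·BM = G: a coset of B meets a coset
-- of AM in at most one coset of A, and two cosets of B in a coset of BM meet no coset of A in common.
-- G = AM ∪ ABA: for x ∈ A and z ∈ BA ∖ A the products x z avoid AM and take each value for a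
-- coset of A ∩ B of choices, so they cover n·|BA ∖ A| = |G| − |AM| elements.  Dually G = BM ∪ BAB.

open import Level using (0ℓ)
open import Data.Bool.Base using (Bool; true)
open import Data.Empty using (⊥; ⊥-elim)
open import Data.Fin using (Fin; zero; suc) renaming (_≤_ to _≤ᶠ_)
open import Data.Fin.Properties using (any?; ¬∀⟶∃¬; suc-injective; ≤-antisym) renaming (_≟_ to _≟ᶠ_)
open import Data.Fin.Subset using (Subset; _∈_; _∉_; _∩_; _∪_; _⊆_; ∣_∣; ∁; inside; outside)
open import Data.Fin.Subset.Properties
  using (_∈?_; drop-there; x∈p∩q⁺; x∈p∩q⁻; x∈p∪q⁻; x∈∁p⇒x∉p; x∉p⇒x∈∁p; ∩-comm; p⊆q⇒∣p∣≤∣q∣; p⊂q⇒∣p∣<∣q∣)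
open import Data.Nat using (ℕ; zero; suc; _+_; _*_; _<_; _≤_; NonZero; ≢-nonZero; z≤n; s≤s)
open import Data.Nat.Properties
  using (+-*-semiring; +-identityʳ; +-cancelˡ-≡; *-comm; *-identityˡ; *-identityʳ; *-cancelˡ-≡; *-cancelʳ-≡;
         <-irrefl; m<m*n; <⇒≱; <⇒≢)
open import Data.Nat.Solver using (module +-*-Solver)
open import Data.Product using (Σ; ∃; ∃₂; _×_; _,_; proj₁; proj₂; map₂; swap)
open import Data.Sum using (_⊎_; inj₁; inj₂; [_,_]′)
open import Data.Unit using (⊤; tt)
open import Data.Vec.Base using (_∷_; []; there)
open import Data.Vec.Properties using (lookup∘tabulate; []=⇒lookup; lookup⇒[]=)
open import Function.Base using (case_of_)
open import Function.Bundles using (_↔_; Inverse; mk↔ₛ′; mk⇔)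
open import Relation.Nullary using (¬_; Dec; yes; no; ¬?; does)
open import Relation.Nullary.Decidable using (_×-dec_; _⊎-dec_; decidable-stable; dec-true; does-⇔; map′)
open import Relation.Unary using (Pred; Decidable)
open import Relation.Unary.Properties using (U?)
open import Relation.Binary.PropositionalEquality
  using (_≡_; _≢_; refl; sym; trans; cong; cong₂; subst; subst₂; module ≡-Reasoning)
open import Algebra.Bundles using (Group)
open import Algebra.Properties.Semiring.Sum +-*-semiring
  using (sum; ∑-comm; ∑-distrib-+; sum-cong-≗; *-distribʳ-sum)
open import Axiom.UniquenessOfIdentityProofs using (module Decidable⇒UIP)
open import Defs

open +-*-Solver using (solve; _:*_; _:+_; _:=_)

-- Counting in Fin m

private
  variable
    m m′ : ℕ

⟦_⟧ : {A : Set} → Dec A → ℕ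
⟦ yes _ ⟧ = 1
⟦ no _ ⟧ = 0

⟦⟧-cong : {A B : Set} (A? : Dec A) (B? : Dec B) → (A → B) → (B → A) → ⟦ A? ⟧ ≡ ⟦ B? ⟧
⟦⟧-cong (yes _) (yes _) _ _ = refl
⟦⟧-cong (yes a) (no ¬b) f _ = ⊥-elim (¬b (f a))
⟦⟧-cong (no ¬a) (yes b) _ g = ⊥-elim (¬a (g b))
⟦⟧-cong (no _) (no _) _ _ = refl

count : {P : Pred (Fin m) 0ℓ} → Decidable P → ℕ
count {m} P? = sum {m} (λ i → ⟦ P? i ⟧)

count-cong : {P Q : Pred (Fin m) 0ℓ} (P? : Decidable P) (Q? : Decidable Q) →
             (∀ i → P i → Q i) → (∀ i → Q i → P i) → count P? ≡ count Q?
count-cong P? Q? f g = sum-cong-≗ (λ i → ⟦⟧-cong (P? i) (Q? i) (f i) (g i))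

count-none : {P : Pred (Fin m) 0ℓ} (P? : Decidable P) → (∀ i → ¬ P i) → count P? ≡ 0
count-none {zero} P? _ = refl
count-none {suc m} P? ¬P with P? zero
... | yes p = ⊥-elim (¬P zero p)
... | no _ = count-none (λ i → P? (suc i)) (λ i → ¬P (suc i))

count-all : {P : Pred (Fin m) 0ℓ} (P? : Decidable P) → (∀ i → P i) → count P? ≡ m
count-all {zero} P? _ = refl
count-all {suc m} P? all with P? zero
... | yes _ = cong suc (count-all (λ i → P? (suc i)) (λ i → all (suc i)))
... | no ¬p = ⊥-elim (¬p (all zero))

count≡0⇒¬ : {P : Pred (Fin m) 0ℓ} (P? : Decidable P) → count P? ≡ 0 → ∀ i → ¬ P i
count≡0⇒¬ {suc m} P? c≡0 i p with P? zero | i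
... | yes _ | _ = case c≡0 of λ ()
... | no ¬p | zero = ¬p p
... | no _ | suc j = count≡0⇒¬ (λ i → P? (suc i)) c≡0 j p

count-unique : {P : Pred (Fin m) 0ℓ} (P? : Decidable P) (i : Fin m) → P i → (∀ j → P j → j ≡ i) → count P? ≡ 1
count-unique {suc m} P? zero p unique with P? zero
... | yes _ = cong suc (count-none (λ j → P? (suc j)) (λ j pj → case unique (suc j) pj of λ ()))
... | no ¬p = ⊥-elim (¬p p)
count-unique {suc m} P? (suc i) p unique with P? zero
... | yes p₀ = case unique zero p₀ of λ ()
... | no _ = count-unique (λ j → P? (suc j)) i p (λ j pj → suc-injective (unique (suc j) pj))

count-split : {P Q : Pred (Fin m) 0ℓ} (P? : Decidable P) (Q? : Decidable Q) →
              count P? ≡ count (λ i → P? i ×-dec Q? i) + count (λ i → P? i ×-dec ¬? (Q? i))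
count-split P? Q? =
  trans (sum-cong-≗ split) (∑-distrib-+ (λ i → ⟦ P? i ×-dec Q? i ⟧) (λ i → ⟦ P? i ×-dec ¬? (Q? i) ⟧))
  where
  split : ∀ i → ⟦ P? i ⟧ ≡ ⟦ P? i ×-dec Q? i ⟧ + ⟦ P? i ×-dec ¬? (Q? i) ⟧
  split i with P? i | Q? i
  ... | yes _ | yes _ = refl
  ... | yes _ | no _ = refl
  ... | no _ | yes _ = refl
  ... | no _ | no _ = refl

sum-indicator : {P : Pred (Fin m) 0ℓ} (P? : Decidable P) (f : Fin m → ℕ) {c : ℕ} →
                (∀ i → P i → f i ≡ c) → (∀ i → ¬ P i → f i ≡ 0) → sum f ≡ count P? * c
sum-indicator {m} P? f {c} onP offP = trans (sum-cong-≗ indicator) (sym (*-distribʳ-sum c (λ i → ⟦ P? i ⟧)))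
  where
  indicator : ∀ i → f i ≡ ⟦ P? i ⟧ * c
  indicator i with P? i
  ... | yes p = trans (onP i p) (sym (*-identityˡ c))
  ... | no ¬p = offP i ¬p

double-count : {P : Pred (Fin m) 0ℓ} {Q : Pred (Fin m′) 0ℓ} {R : Fin m → Fin m′ → Set}
               (P? : Decidable P) (Q? : Decidable Q) (R? : ∀ x y → Dec (R x y)) {c d : ℕ} →
               (∀ x y → R x y → P x × Q y) →
               (∀ x → P x → count (R? x) ≡ c) → (∀ y → Q y → count (λ x → R? x y) ≡ d) →
               count P? * c ≡ count Q? * d
double-count P? Q? R? {c} {d} R⇒P×Q rows columns = begin
  count P? * c                     ≡⟨ sum-indicator P? _ rows empty-row ⟨
  sum (λ x → count (R? x))         ≡⟨ ∑-comm (λ x y → ⟦ R? x y ⟧) ⟩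
  sum (λ y → count (λ x → R? x y)) ≡⟨ sum-indicator Q? _ columns empty-column ⟩
  count Q? * d                     ∎
  where
  open ≡-Reasoning
  empty-row : ∀ x → ¬ _ → count (R? x) ≡ 0
  empty-row x ¬p = count-none (R? x) (λ y r → ¬p (proj₁ (R⇒P×Q x y r)))
  empty-column : ∀ y → ¬ _ → count (λ x → R? x y) ≡ 0
  empty-column y ¬q = count-none (λ x → R? x y) (λ x r → ¬q (proj₂ (R⇒P×Q x y r)))

count-bijection : {P : Pred (Fin m) 0ℓ} {Q : Pred (Fin m′) 0ℓ} (P? : Decidable P) (Q? : Decidable Q)
                  (f : Fin m → Fin m′) → (∀ x → P x → Q (f x)) →
                  (∀ x x′ → P x → P x′ → f x ≡ f x′ → x ≡ x′) → (∀ y → Q y → ∃ λ x → P x × f x ≡ y) →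
                  count P? ≡ count Q?
count-bijection {P = P} {Q} P? Q? f into injective onto =
  *-cancelʳ-≡ _ _ 1 (double-count P? Q? graph? onGraph rows columns)
  where
  graph? : ∀ x y → Dec (P x × f x ≡ y)
  graph? x y = P? x ×-dec (f x ≟ᶠ y)
  onGraph : ∀ x y → P x × f x ≡ y → P x × Q y
  onGraph x _ (p , refl) = p , into x p
  rows : ∀ x → P x → count (graph? x) ≡ 1
  rows x p = count-unique (graph? x) (f x) (p , refl) (λ _ e → sym (proj₂ e))
  columns : ∀ y → Q y → count (λ x → graph? x y) ≡ 1
  columns y q with onto y q
  ... | x , p , fx≡y = count-unique (λ x → graph? x y) x (p , fx≡y)
                         (λ x′ e → injective x′ x (proj₁ e) p (trans (proj₂ e) (sym fx≡y)))

count-complement : {P : Pred (Fin m) 0ℓ} (P? : Decidable P) → count P? + count (λ i → ¬? (P? i)) ≡ m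
count-complement {m} P? = begin
  count P? + count (λ i → ¬? (P? i))
    ≡⟨ cong₂ _+_ (count-cong P? (λ i → U? i ×-dec P? i) (λ _ p → tt , p) (λ _ → proj₂))
                 (count-cong _ (λ i → U? i ×-dec ¬? (P? i)) (λ _ p → tt , p) (λ _ → proj₂)) ⟩
  count (λ i → U? i ×-dec P? i) + count (λ i → U? i ×-dec ¬? (P? i))
    ≡⟨ count-split U? P? ⟨
  count {m} U?
    ≡⟨ count-all U? (λ _ → tt) ⟩
  m ∎
  where open ≡-Reasoning

count-cover : {P Q : Pred (Fin m) 0ℓ} (P? : Decidable P) (Q? : Decidable Q) →
              (∀ i → P i → ¬ Q i) → count P? + count Q? ≡ m → ∀ i → P i ⊎ Q i
count-cover {m} {P} {Q} P? Q? disjoint total i =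
  decidable-stable (P⊎Q? i) (count≡0⇒¬ (λ i → ¬? (P⊎Q? i)) nothing-outside i)
  where
  P⊎Q? : Decidable (λ i → P i ⊎ Q i)
  P⊎Q? i = P? i ⊎-dec Q? i
  P⊎Q-count : count P⊎Q? ≡ m
  P⊎Q-count = begin
    count P⊎Q?
      ≡⟨ count-split P⊎Q? P? ⟩
    count (λ i → P⊎Q? i ×-dec P? i) + count (λ i → P⊎Q? i ×-dec ¬? (P? i))
      ≡⟨ cong₂ _+_ (count-cong _ P? (λ _ → proj₂) (λ _ p → inj₁ p , p))
                   (count-cong _ Q? onlyQ (λ _ q → inj₂ q , λ p → disjoint _ p q)) ⟩
    count P? + count Q?
      ≡⟨ total ⟩
    m ∎
    where
    open ≡-Reasoning
    onlyQ : ∀ i → (P i ⊎ Q i) × ¬ P i → Q i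
    onlyQ _ (inj₁ p , ¬p) = ⊥-elim (¬p p)
    onlyQ _ (inj₂ q , _) = q
  nothing-outside : count (λ i → ¬? (P⊎Q? i)) ≡ 0
  nothing-outside = +-cancelˡ-≡ (count P⊎Q?) _ 0
    (trans (count-complement P⊎Q?) (trans (sym P⊎Q-count) (sym (+-identityʳ _))))

Σ↔Fin-count : {P : Pred (Fin m) 0ℓ} (P? : Decidable P) → (∀ i (p q : P i) → p ≡ q) →
              Σ (Fin m) P ↔ Fin (count P?)
Σ↔Fin-count {zero} P? _ = mk↔ₛ′ (λ ()) (λ ()) (λ ()) (λ ())
Σ↔Fin-count {suc m} {P} P? irrelevant with P? zero | Σ↔Fin-count (λ i → P? (suc i)) (λ i → irrelevant (suc i))
... | yes p₀ | rest = mk↔ₛ′ to from to∘from from∘to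
  where
  module R = Inverse rest
  to : Σ (Fin (suc m)) P → Fin (suc (count (λ i → P? (suc i))))
  to (zero , _) = zero
  to (suc i , p) = suc (R.to (i , p))
  from : Fin (suc (count (λ i → P? (suc i)))) → Σ (Fin (suc m)) P
  from zero = zero , p₀
  from (suc j) = suc (proj₁ (R.from j)) , proj₂ (R.from j)
  to∘from : ∀ j → to (from j) ≡ j
  to∘from zero = refl
  to∘from (suc j) = cong suc (R.strictlyInverseˡ j)
  from∘to : ∀ x → from (to x) ≡ x
  from∘to (zero , p) = cong (zero ,_) (irrelevant zero p₀ p)
  from∘to (suc i , p) = cong (λ (j , q) → suc j , q) (R.strictlyInverseʳ (i , p))
... | no ¬p₀ | rest = mk↔ₛ′ to from R.strictlyInverseˡ from∘to
  where
  module R = Inverse rest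
  to : Σ (Fin (suc m)) P → Fin (count (λ i → P? (suc i)))
  to (zero , p) = ⊥-elim (¬p₀ p)
  to (suc i , p) = R.to (i , p)
  from : Fin (count (λ i → P? (suc i))) → Σ (Fin (suc m)) P
  from j = suc (proj₁ (R.from j)) , proj₂ (R.from j)
  from∘to : ∀ x → from (to x) ≡ x
  from∘to (zero , p) = ⊥-elim (¬p₀ p)
  from∘to (suc i , p) = cong (λ (j , q) → suc j , q) (R.strictlyInverseʳ (i , p))

count-tail : ∀ {x} (S : Subset m) → count (_∈? S) ≡ count (λ i → suc i ∈? (x ∷ S))
count-tail S = count-cong (_∈? S) (λ i → suc i ∈? (_ ∷ S)) (λ _ → there) (λ _ → drop-there)

∣p∣≡count : (S : Subset m) → ∣ S ∣ ≡ count (_∈? S)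
∣p∣≡count [] = refl
∣p∣≡count (inside ∷ S) = cong suc (trans (∣p∣≡count S) (count-tail S))
∣p∣≡count (outside ∷ S) = trans (∣p∣≡count S) (count-tail S)

∀∈⇒∣p∣≡n : {S : Subset m} → (∀ x → x ∈ S) → ∣ S ∣ ≡ m
∀∈⇒∣p∣≡n {S = S} all = trans (∣p∣≡count S) (count-all (_∈? S) all)

∈⇒∣p∣-nonZero : ∀ {S : Subset m} {x} → x ∈ S → NonZero ∣ S ∣
∈⇒∣p∣-nonZero {S = S} {x} x∈S =
  ≢-nonZero (λ ∣S∣≡0 → count≡0⇒¬ (_∈? S) (trans (sym (∣p∣≡count S)) ∣S∣≡0) x x∈S)

p⊆q∧∣p∣≡∣q∣⇒q⊆p : {p q : Subset m} → p ⊆ q → ∣ p ∣ ≡ ∣ q ∣ → q ⊆ p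
p⊆q∧∣p∣≡∣q∣⇒q⊆p {p = p} p⊆q ∣p∣≡∣q∣ {x} x∈q with x ∈? p
... | yes x∈p = x∈p
... | no x∉p = ⊥-elim (<-irrefl ∣p∣≡∣q∣ (p⊂q⇒∣p∣<∣q∣ (p⊆q , x , x∈q , x∉p)))

∣p∣+∣q∣≡n⇒cover : {p q : Subset m} → (∀ {x} → x ∈ p → x ∉ q) → ∣ p ∣ + ∣ q ∣ ≡ m → ∀ x → x ∈ p ⊎ x ∈ q
∣p∣+∣q∣≡n⇒cover {p = p} {q} disjoint total =
  count-cover (_∈? p) (_∈? q) (λ _ → disjoint) (trans (sym (cong₂ _+_ (∣p∣≡count p) (∣p∣≡count q))) total)

least-witness : {P : Pred (Fin m) 0ℓ} → Decidable P → ∃ P → ∃ λ i → P i × (∀ j → P j → i ≤ᶠ j)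
least-witness {suc m} P? (i , p) with P? zero | i
... | yes p₀ | _ = zero , p₀ , λ _ _ → z≤n
... | no ¬p₀ | zero = ⊥-elim (¬p₀ p)
... | no ¬p₀ | suc i′ with least-witness (λ j → P? (suc j)) (i′ , p)
...   | j , pj , below = suc j , pj , λ { zero p₀ → ⊥-elim (¬p₀ p₀) ; (suc k) pk → s≤s (below k pk) }

from-does : {A : Set} (A? : Dec A) → does A? ≡ true → A
from-does (yes a) _ = a

Fin⇒NonZero : Fin m → NonZero m
Fin⇒NonZero zero = _
Fin⇒NonZero (suc _) = _

-- Left cosets and products of subsets of a finite group

module GroupTheory {N : ℕ} (G : FiniteGroup N) where

  group : Group 0ℓ 0ℓ
  group = record { Carrier = Fin N ; _≈_ = _≡_ ; isGroup = FiniteGroup.isGroup G }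

  open Group group public using (_∙_; ε; _⁻¹; _\\_; _//_; assoc; identityˡ; identityʳ; inverseˡ)
  open import Algebra.Properties.Group group public
    using (ε⁻¹≈ε; ⁻¹-involutive; ⁻¹-anti-homo-∙; ⁻¹-anti-homo-\\; ⁻¹-anti-homo-//;
           \\-leftDividesˡ; \\-leftDividesʳ; //-rightDividesˡ; //-rightDividesʳ; y≈x\\z; x≈z//y; ∙-cancelˡ)

  \\-trans : ∀ x y z → (x \\ y) ∙ (y \\ z) ≡ x \\ z
  \\-trans x y z = trans (assoc (x ⁻¹) y (y \\ z)) (cong (x ⁻¹ ∙_) (\\-leftDividesˡ y z))

  \\-translate : ∀ g x y → (g ∙ x) \\ (g ∙ y) ≡ x \\ y
  \\-translate g x y = begin
    (g ∙ x) ⁻¹ ∙ (g ∙ y)     ≡⟨ cong (_∙ (g ∙ y)) (⁻¹-anti-homo-∙ g x) ⟩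
    x ⁻¹ ∙ g ⁻¹ ∙ (g ∙ y)    ≡⟨ assoc (x ⁻¹) (g ⁻¹) (g ∙ y) ⟩
    x ⁻¹ ∙ (g \\ (g ∙ y))    ≡⟨ cong (x ⁻¹ ∙_) (\\-leftDividesʳ g y) ⟩
    x \\ y                   ∎
    where open ≡-Reasoning

  ε\\ : ∀ x → ε \\ x ≡ x
  ε\\ x = trans (cong (_∙ x) ε⁻¹≈ε) (identityˡ x)

  \\-∙ : ∀ x y z → (x ∙ y) \\ z ≡ y \\ (x \\ z)
  \\-∙ x y z = trans (cong (_∙ z) (⁻¹-anti-homo-∙ x y)) (assoc (y ⁻¹) (x ⁻¹) z)

  //-\\ : ∀ x y → (x // y) \\ x ≡ y
  //-\\ x y = trans (cong (_∙ x) (⁻¹-anti-homo-// x y)) (//-rightDividesˡ x y)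

  \\-∙-cancel : ∀ {a a′ x w} → a \\ a′ ≡ x ∙ w → (a ∙ x) \\ a′ ≡ w
  \\-∙-cancel {a} {a′} {x} {w} e = trans (\\-∙ a x a′) (trans (cong (x \\_) e) (\\-leftDividesʳ x w))

  \\//\\ : ∀ x y g → (x \\ g) // (y \\ g) ≡ x \\ y
  \\//\\ x y g = trans (cong ((x \\ g) ∙_) (⁻¹-anti-homo-\\ y g)) (\\-trans x g y)

  action-⁻¹ : ∀ {X : Set} (act : Fin N → X → X) → (∀ x → act ε x ≡ x) →
              (∀ g h x → act (g ∙ h) x ≡ act g (act h x)) → ∀ g x → act (g ⁻¹) (act g x) ≡ x
  action-⁻¹ act act-ε act-∙ g x = trans (sym (act-∙ (g ⁻¹) g x)) (trans (cong (λ e → act e x) (inverseˡ g)) (act-ε x))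

  infixl 8 _⋆_
  _⋆_ : Subset N → Subset N → Subset N
  _⋆_ = _·_ G

  ∈⋆⁺ : ∀ {S T s t} → s ∈ S → t ∈ T → s ∙ t ∈ S ⋆ T
  ∈⋆⁺ {S} {T} {s} {t} s∈S t∈T = lookup⇒[]= (s ∙ t) (S ⋆ T)
    (trans (lookup∘tabulate _ (s ∙ t)) (dec-true (any? λ s′ → any? λ t′ → _) (s , t , s∈S , t∈T , refl)))

  ∈⋆⁻ : ∀ {S T g} → g ∈ S ⋆ T → ∃₂ λ s t → s ∈ S × t ∈ T × s ∙ t ≡ g
  ∈⋆⁻ {S} {T} {g} g∈ST =
    from-does (any? λ s → any? λ t → (s ∈? S) ×-dec ((t ∈? T) ×-dec ((s ∙ t) ≟ᶠ g)))
      (trans (sym (lookup∘tabulate _ g)) ([]=⇒lookup g∈ST))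

  ⋆-monoʳ : ∀ {S T T′} → T ⊆ T′ → S ⋆ T ⊆ S ⋆ T′
  ⋆-monoʳ {S} {T} {T′} T⊆T′ g∈ST with ∈⋆⁻ g∈ST
  ... | s , t , s∈S , t∈T , st≡g = subst (_∈ S ⋆ T′) st≡g (∈⋆⁺ s∈S (T⊆T′ t∈T))

  ⋆-full-swap : ∀ {X Y} → IsSubgroup G X → IsSubgroup G Y → (∀ g → g ∈ X ⋆ Y) → ∀ g → g ∈ Y ⋆ X
  ⋆-full-swap {X} {Y} X-sub Y-sub X⋆Y-full g =
    let (x , y , x∈X , y∈Y , xy≡g⁻¹) = ∈⋆⁻ (X⋆Y-full (g ⁻¹))
    in subst (_∈ Y ⋆ X) (trans (sym (⁻¹-anti-homo-∙ x y)) (trans (cong _⁻¹ xy≡g⁻¹) (⁻¹-involutive g)))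
         (∈⋆⁺ (IsSubgroup.⁻¹∈ Y-sub y∈Y) (IsSubgroup.⁻¹∈ X-sub x∈X))

  module Cosets {H : Subset N} (H-sub : IsSubgroup G H) where
    open IsSubgroup H-sub

    infix 4 _∼_ _∼?_
    _∼_ : Fin N → Fin N → Set
    x ∼ y = x \\ y ∈ H

    _∼?_ : ∀ x y → Dec (x ∼ y)
    x ∼? y = x \\ y ∈? H

    ∼-refl : ∀ {x} → x ∼ x
    ∼-refl {x} = subst (_∈ H) (sym (inverseˡ x)) ε∈

    ∼-sym : ∀ {x y} → x ∼ y → y ∼ x
    ∼-sym {x} {y} x∼y = subst (_∈ H) (⁻¹-anti-homo-\\ x y) (⁻¹∈ x∼y)

    ∼-trans : ∀ {x y z} → x ∼ y → y ∼ z → x ∼ z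
    ∼-trans {x} {y} {z} x∼y y∼z = subst (_∈ H) (\\-trans x y z) (∙∈ x∼y y∼z)

    ∼-resp : ∀ {x x′ y y′} → x ∼ x′ → y ∼ y′ → x ∼ y → x′ ∼ y′
    ∼-resp x∼x′ y∼y′ x∼y = ∼-trans (∼-sym x∼x′) (∼-trans x∼y y∼y′)

    ∙-∼ : ∀ g {x y} → x ∼ y → g ∙ x ∼ g ∙ y
    ∙-∼ g {x} {y} = subst (_∈ H) (sym (\\-translate g x y))

    ∙-∼⁻ : ∀ g {x y} → g ∙ x ∼ g ∙ y → x ∼ y
    ∙-∼⁻ g {x} {y} = subst (_∈ H) (\\-translate g x y)

    //-∙-∼ : ∀ {r x r′ x′} → r ∼ x → r′ ∼ x′ → (x′ // x) ∙ r ∼ r′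
    //-∙-∼ {r} {x} {r′} {x′} r∼x r′∼x′ =
      ∼-trans (subst ((x′ // x) ∙ r ∼_) (//-rightDividesˡ x x′) (∙-∼ (x′ // x) r∼x)) (∼-sym r′∼x′)

    ∼-∙ : ∀ x {h} → h ∈ H → x ∼ x ∙ h
    ∼-∙ x {h} = subst (_∈ H) (sym (\\-leftDividesʳ x h))

    ∈⇒ε∼ : ∀ {h} → h ∈ H → ε ∼ h
    ∈⇒ε∼ {h} = subst (_∈ H) (sym (ε\\ h))

    ε∼⇒∈ : ∀ {h} → ε ∼ h → h ∈ H
    ε∼⇒∈ {h} = subst (_∈ H) (ε\\ h)

    rep : Fin N → Fin N
    rep g = proj₁ (least-witness (g ∼?_) (g , ∼-refl))

    ∼-rep : ∀ g → g ∼ rep g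
    ∼-rep g = proj₁ (proj₂ (least-witness (g ∼?_) (g , ∼-refl)))

    rep-least : ∀ {g y} → g ∼ y → rep g ≤ᶠ y
    rep-least {g} {y} = proj₂ (proj₂ (least-witness (g ∼?_) (g , ∼-refl))) y

    rep-cong : ∀ {g g′} → g ∼ g′ → rep g ≡ rep g′
    rep-cong {g} {g′} g∼g′ =
      ≤-antisym (rep-least (∼-trans g∼g′ (∼-rep g′))) (rep-least (∼-trans (∼-sym g∼g′) (∼-rep g)))

    Coset : Set
    Coset = Σ (Fin N) λ r → rep r ≡ r

    repr : Coset → Fin N
    repr = proj₁

    [_] : Fin N → Coset
    [ g ] = rep g , rep-cong (∼-sym (∼-rep g))

    Coset-≡ : ∀ {p q : Coset} → repr p ≡ repr q → p ≡ q
    Coset-≡ {r , e} {.r , e′} refl = cong (r ,_) (Decidable⇒UIP.≡-irrelevant _≟ᶠ_ e e′)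

    []-cong : ∀ {x y} → x ∼ y → [ x ] ≡ [ y ]
    []-cong x∼y = Coset-≡ (rep-cong x∼y)

    []-repr : ∀ p → [ repr p ] ≡ p
    []-repr (_ , canonical) = Coset-≡ canonical

    ∼-repr : ∀ {x} p → x ∼ repr p → [ x ] ≡ p
    ∼-repr p x∼p = trans ([]-cong x∼p) ([]-repr p)

    ∼⇒≡ : ∀ p q → repr p ∼ repr q → p ≡ q
    ∼⇒≡ p q p∼q = trans (sym ([]-repr p)) (∼-repr q p∼q)

    ≡⇒∼ : ∀ {x y} → [ x ] ≡ [ y ] → x ∼ y
    ≡⇒∼ {x} {y} e = ∼-trans (∼-rep x) (subst (_∼ y) (sym (cong repr e)) (∼-sym (∼-rep y)))

    _≟_ : (p q : Coset) → Dec (p ≡ q)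
    p ≟ q = map′ Coset-≡ (cong repr) (repr p ≟ᶠ repr q)

    infixr 5 _⊙_
    _⊙_ : Fin N → Coset → Coset
    g ⊙ p = [ g ∙ repr p ]

    ∼-⊙ : ∀ g p → g ∙ repr p ∼ repr (g ⊙ p)
    ∼-⊙ g p = ∼-rep (g ∙ repr p)

    ε-⊙ : ∀ p → ε ⊙ p ≡ p
    ε-⊙ p = ∼-repr p (subst (_∼ repr p) (sym (identityˡ (repr p))) ∼-refl)

    ∙-⊙ : ∀ g h p → (g ∙ h) ⊙ p ≡ g ⊙ (h ⊙ p)
    ∙-⊙ g h p = []-cong (subst (_∼ g ∙ repr (h ⊙ p)) (sym (assoc g h (repr p))) (∙-∼ g (∼-⊙ h p)))

    index : ℕ
    index = count (λ r → rep r ≟ᶠ r)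

    Coset↔Fin-index : Coset ↔ Fin index
    Coset↔Fin-index = Σ↔Fin-count (λ r → rep r ≟ᶠ r) (λ _ → Decidable⇒UIP.≡-irrelevant _≟ᶠ_)

    index*∣H∣≡N : index * ∣ H ∣ ≡ N
    index*∣H∣≡N = begin
      index * ∣ H ∣      ≡⟨ double-count (λ r → rep r ≟ᶠ r) U? (λ r g → rep g ≟ᶠ r) on-graph coset-size one-rep ⟩
      count {N} U? * 1   ≡⟨ *-identityʳ _ ⟩
      count {N} U?       ≡⟨ count-all U? (λ _ → tt) ⟩
      N                  ∎
      where
      open ≡-Reasoning
      on-graph : ∀ r g → rep g ≡ r → rep r ≡ r × ⊤
      on-graph _ g refl = rep-cong (∼-sym (∼-rep g)) , tt
      one-rep : ∀ g → ⊤ → count (λ r → rep g ≟ᶠ r) ≡ 1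
      one-rep g _ = count-unique (λ r → rep g ≟ᶠ r) (rep g) refl (λ _ e → sym e)
      coset-size : ∀ r → rep r ≡ r → count (λ g → rep g ≟ᶠ r) ≡ ∣ H ∣
      coset-size r canonical = sym (trans (∣p∣≡count H) (count-bijection (_∈? H) (λ g → rep g ≟ᶠ r) (r ∙_)
        (λ h h∈H → trans (sym (rep-cong (∼-∙ r h∈H))) canonical)
        (λ h h′ _ _ → ∙-cancelˡ r h h′)
        (λ g rep≡r → r \\ g , subst (_∼ g) rep≡r (∼-sym (∼-rep g)) , \\-leftDividesˡ r g)))

  -- Double counting of the pairs (x, g) with x ∈ X and x \\ g ∈ S: each row has |S| entries and
  -- each nonempty column is a left translate of K.
  ⋆-cardinality : ∀ {X S K} → IsSubgroup G X → K ⊆ X → (∀ {t z} → t ∈ K → z ∈ S → t \\ z ∈ S) →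
                  (∀ {z z′} → z ∈ S → z′ ∈ S → z // z′ ∈ X → z // z′ ∈ K) →
                  ∣ X ∣ * ∣ S ∣ ≡ ∣ X ⋆ S ∣ * ∣ K ∣
  ⋆-cardinality {X} {S} {K} X-sub K⊆X K\\S⊆S S//S⊆K = begin
    ∣ X ∣ * ∣ S ∣                 ≡⟨ cong (_* ∣ S ∣) (∣p∣≡count X) ⟩
    count (_∈? X) * ∣ S ∣         ≡⟨ double-count (_∈? X) (_∈? (X ⋆ S)) R? on-graph row column ⟩
    count (_∈? (X ⋆ S)) * ∣ K ∣   ≡⟨ cong (_* ∣ K ∣) (∣p∣≡count (X ⋆ S)) ⟨
    ∣ X ⋆ S ∣ * ∣ K ∣             ∎
    where
    open ≡-Reasoning
    open IsSubgroup X-sub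
    R? : ∀ x g → Dec (x ∈ X × x \\ g ∈ S)
    R? x g = (x ∈? X) ×-dec (x \\ g ∈? S)
    on-graph : ∀ x g → x ∈ X × x \\ g ∈ S → x ∈ X × g ∈ X ⋆ S
    on-graph x g (x∈X , x\\g∈S) = x∈X , subst (_∈ X ⋆ S) (\\-leftDividesˡ x g) (∈⋆⁺ x∈X x\\g∈S)
    row : ∀ x → x ∈ X → count (R? x) ≡ ∣ S ∣
    row x x∈X = sym (trans (∣p∣≡count S) (count-bijection (_∈? S) (R? x) (x ∙_)
      (λ z z∈S → x∈X , subst (_∈ S) (sym (\\-leftDividesʳ x z)) z∈S)
      (λ z z′ _ _ → ∙-cancelˡ x z z′)
      (λ g x-related-g → x \\ g , proj₂ x-related-g , \\-leftDividesˡ x g)))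
    column : ∀ g → g ∈ X ⋆ S → count (λ x → R? x g) ≡ ∣ K ∣
    column g g∈XS with ∈⋆⁻ g∈XS
    ... | x₀ , z₀ , x₀∈X , z₀∈S , x₀z₀≡g = sym (trans (∣p∣≡count K) (count-bijection (_∈? K) (λ x → R? x g) (x₀ ∙_)
      (λ t t∈K → ∙∈ x₀∈X (K⊆X t∈K) , subst (_∈ S) (sym (\\-∙ x₀ t g)) (K\\S⊆S t∈K x₀\\g∈S))
      (λ t t′ _ _ → ∙-cancelˡ x₀ t t′)
      (λ x x-related-g → x₀ \\ x , x₀\\x∈K x x-related-g , \\-leftDividesˡ x₀ x)))
      where
      x₀\\g∈S : x₀ \\ g ∈ S
      x₀\\g∈S = subst (_∈ S) (y≈x\\z x₀ z₀ g x₀z₀≡g) z₀∈S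
      x₀\\x∈K : ∀ x → x ∈ X × x \\ g ∈ S → x₀ \\ x ∈ K
      x₀\\x∈K x (x∈X , x\\g∈S) = subst (_∈ K) (\\//\\ x₀ x g)
        (S//S⊆K x₀\\g∈S x\\g∈S (subst (_∈ X) (sym (\\//\\ x₀ x g)) (∙∈ (⁻¹∈ x₀∈X) x∈X)))

  ∣X∣*∣Y∣≡∣X⋆Y∣*∣X∩Y∣ : ∀ {X Y} → IsSubgroup G X → IsSubgroup G Y → ∣ X ∣ * ∣ Y ∣ ≡ ∣ X ⋆ Y ∣ * ∣ X ∩ Y ∣
  ∣X∣*∣Y∣≡∣X⋆Y∣*∣X∩Y∣ {X} {Y} X-sub Y-sub = ⋆-cardinality X-sub (λ t∈X∩Y → proj₁ (x∈p∩q⁻ X Y t∈X∩Y))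
    (λ t∈X∩Y z∈Y → Y.∙∈ (Y.⁻¹∈ (proj₂ (x∈p∩q⁻ X Y t∈X∩Y))) z∈Y)
    (λ z∈Y z′∈Y z//z′∈X → x∈p∩q⁺ (z//z′∈X , Y.∙∈ z∈Y (Y.⁻¹∈ z′∈Y)))
    where module Y = IsSubgroup Y-sub

  ⋆-full⇒∩⊆ : ∀ {X X′ Y} → IsSubgroup G X → IsSubgroup G Y → X′ ⊆ X → (∀ g → g ∈ X ⋆ Y) →
              ∣ X ∣ * ∣ Y ∣ ≡ N * ∣ X′ ∩ Y ∣ → ∀ {z} → z ∈ X → z ∈ Y → z ∈ X′
  ⋆-full⇒∩⊆ {X} {X′} {Y} X-sub Y-sub X′⊆X X⋆Y-full ∣X∣*∣Y∣≡N*k z∈X z∈Y =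
    proj₁ (x∈p∩q⁻ X′ Y (p⊆q∧∣p∣≡∣q∣⇒q⊆p X′∩Y⊆X∩Y (sym same-size) (x∈p∩q⁺ (z∈X , z∈Y))))
    where
    instance
      N-nonZero : NonZero N
      N-nonZero = Fin⇒NonZero ε
    X′∩Y⊆X∩Y : X′ ∩ Y ⊆ X ∩ Y
    X′∩Y⊆X∩Y z∈X′∩Y = let (z∈X′ , z∈Y) = x∈p∩q⁻ X′ Y z∈X′∩Y in x∈p∩q⁺ (X′⊆X z∈X′ , z∈Y)
    same-size : ∣ X ∩ Y ∣ ≡ ∣ X′ ∩ Y ∣
    same-size = *-cancelˡ-≡ _ _ N (begin
      N * ∣ X ∩ Y ∣         ≡⟨ cong (_* ∣ X ∩ Y ∣) (∀∈⇒∣p∣≡n X⋆Y-full) ⟨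
      ∣ X ⋆ Y ∣ * ∣ X ∩ Y ∣ ≡⟨ ∣X∣*∣Y∣≡∣X⋆Y∣*∣X∩Y∣ X-sub Y-sub ⟨
      ∣ X ∣ * ∣ Y ∣         ≡⟨ ∣X∣*∣Y∣≡N*k ⟩
      N * ∣ X′ ∩ Y ∣        ∎)
      where open ≡-Reasoning

  module Covering {X Y W : Subset N} (X-sub : IsSubgroup G X) (Y-sub : IsSubgroup G Y) (W-sub : IsSubgroup G W)
    (X⊆W : X ⊆ W) (W∩Y⊆X : ∀ {z} → z ∈ W → z ∈ Y → z ∈ X)
    (XY∩YX⊆X∪Y : ∀ {z} → z ∈ X ⋆ Y → z ∈ Y ⋆ X → z ∈ X ⊎ z ∈ Y)
    {n k : ℕ} (∣X∣≡nk : ∣ X ∣ ≡ n * k) (∣Y∣≡nk : ∣ Y ∣ ≡ n * k) (∣X∩Y∣≡k : ∣ X ∩ Y ∣ ≡ k)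
    (∣W∣≡nnk : ∣ W ∣ ≡ n * n * k) (N≡nnnk : N ≡ n * n * n * k) where
    private
      module X = IsSubgroup X-sub
      module Y = IsSubgroup Y-sub
      module W = IsSubgroup W-sub

    D : Subset N
    D = Y ⋆ X ∩ ∁ X

    ∈D⁻ : ∀ {z} → z ∈ D → (∃₂ λ y a → y ∈ Y × a ∈ X × y ∙ a ≡ z) × z ∉ X
    ∈D⁻ z∈D = let (z∈YX , z∈∁X) = x∈p∩q⁻ (Y ⋆ X) (∁ X) z∈D in ∈⋆⁻ z∈YX , x∈∁p⇒x∉p z∈∁X

    X∩Y\\D⊆D : ∀ {t z} → t ∈ X ∩ Y → z ∈ D → t \\ z ∈ D
    X∩Y\\D⊆D {t} {z} t∈X∩Y z∈D with x∈p∩q⁻ X Y t∈X∩Y | ∈D⁻ z∈D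
    ... | t∈X , t∈Y | (y , a , y∈Y , a∈X , ya≡z) , z∉X =
      x∈p∩q⁺ (subst (_∈ Y ⋆ X) (trans (assoc (t ⁻¹) y a) (cong (t \\_) ya≡z)) (∈⋆⁺ (Y.∙∈ (Y.⁻¹∈ t∈Y) y∈Y) a∈X) ,
              x∉p⇒x∈∁p (λ t\\z∈X → z∉X (subst (_∈ X) (\\-leftDividesˡ t z) (X.∙∈ t∈X t\\z∈X))))

    -- For z = y a and t = z z′⁻¹ ∈ X, u = t⁻¹ y lies in XY ∩ YX; u ∈ X would put z in X.
    D//D⊆X∩Y : ∀ {z z′} → z ∈ D → z′ ∈ D → z // z′ ∈ X → z // z′ ∈ X ∩ Y
    D//D⊆X∩Y {z} {z′} z∈D z′∈D t∈X with ∈D⁻ z∈D | ∈D⁻ z′∈D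
    ... | (y , a , y∈Y , a∈X , ya≡z) , z∉X | (y′ , a′ , y′∈Y , a′∈X , y′a′≡z′) , _ =
      x∈p∩q⁺ (t∈X , t∈Y (XY∩YX⊆X∪Y (∈⋆⁺ (X.⁻¹∈ t∈X) y∈Y) u∈YX))
      where
      t u : Fin N
      t = z // z′
      u = t \\ y
      u∈YX : u ∈ Y ⋆ X
      u∈YX = subst (_∈ Y ⋆ X) (begin
        y′ ∙ (a′ // a)   ≡⟨ assoc y′ a′ (a ⁻¹) ⟨
        (y′ ∙ a′) // a   ≡⟨ cong (_// a) (trans y′a′≡z′ (sym (//-\\ z z′))) ⟩
        (t \\ z) // a   ≡⟨ assoc (t ⁻¹) z (a ⁻¹) ⟩
        t \\ (z // a)   ≡⟨ cong (t \\_) (x≈z//y y a z ya≡z) ⟨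
        u                ∎) (∈⋆⁺ y′∈Y (X.∙∈ a′∈X (X.⁻¹∈ a∈X)))
        where open ≡-Reasoning
      t∈Y : u ∈ X ⊎ u ∈ Y → t ∈ Y
      t∈Y (inj₁ u∈X) = ⊥-elim (z∉X (subst (_∈ X) ya≡z (X.∙∈ y∈X a∈X)))
        where
        y∈X : y ∈ X
        y∈X = subst (_∈ X) (\\-leftDividesˡ t y) (X.∙∈ t∈X u∈X)
      t∈Y (inj₂ u∈Y) = subst (_∈ Y) (sym (x≈z//y t u y (\\-leftDividesˡ t y))) (Y.∙∈ y∈Y (Y.⁻¹∈ u∈Y))

    private
      instance
        k-nonZero : NonZero k
        k-nonZero = subst NonZero ∣X∩Y∣≡k (∈⇒∣p∣-nonZero (x∈p∩q⁺ (X.ε∈ , Y.ε∈)))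

    n*∣D∣≡∣X⋆D∣ : n * ∣ D ∣ ≡ ∣ X ⋆ D ∣
    n*∣D∣≡∣X⋆D∣ = *-cancelʳ-≡ _ _ k (begin
      n * ∣ D ∣ * k           ≡⟨ solve 3 (λ n d k → n :* d :* k := n :* k :* d) refl n ∣ D ∣ k ⟩
      n * k * ∣ D ∣           ≡⟨ cong (_* ∣ D ∣) ∣X∣≡nk ⟨
      ∣ X ∣ * ∣ D ∣           ≡⟨ ⋆-cardinality X-sub (λ t∈X∩Y → proj₁ (x∈p∩q⁻ X Y t∈X∩Y)) X∩Y\\D⊆D D//D⊆X∩Y ⟩
      ∣ X ⋆ D ∣ * ∣ X ∩ Y ∣   ≡⟨ cong (∣ X ⋆ D ∣ *_) ∣X∩Y∣≡k ⟩
      ∣ X ⋆ D ∣ * k           ∎)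
      where open ≡-Reasoning

    ∣Y⋆X∣≡∣X∣+∣D∣ : ∣ Y ⋆ X ∣ ≡ ∣ X ∣ + ∣ D ∣
    ∣Y⋆X∣≡∣X∣+∣D∣ = begin
      ∣ Y ⋆ X ∣
        ≡⟨ trans (∣p∣≡count (Y ⋆ X)) (count-split (_∈? Y ⋆ X) (_∈? X)) ⟩
      count (λ z → (z ∈? Y ⋆ X) ×-dec (z ∈? X)) + count (λ z → (z ∈? Y ⋆ X) ×-dec ¬? (z ∈? X))
        ≡⟨ cong₂ _+_ (count-cong _ (_∈? X) (λ _ → proj₂) (λ _ z∈X → X⊆Y⋆X z∈X , z∈X))
                     (count-cong _ (_∈? D) (λ _ (z∈YX , z∉X) → x∈p∩q⁺ (z∈YX , x∉p⇒x∈∁p z∉X))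
                                           (λ _ z∈D → proj₁ (x∈p∩q⁻ (Y ⋆ X) _ z∈D) , proj₂ (∈D⁻ z∈D))) ⟩
      count (_∈? X) + count (_∈? D)
        ≡⟨ cong₂ _+_ (∣p∣≡count X) (∣p∣≡count D) ⟨
      ∣ X ∣ + ∣ D ∣ ∎
      where
      open ≡-Reasoning
      X⊆Y⋆X : X ⊆ Y ⋆ X
      X⊆Y⋆X {x} x∈X = subst (_∈ Y ⋆ X) (identityˡ x) (∈⋆⁺ Y.ε∈ x∈X)

    ∣Y⋆X∣≡nnk : ∣ Y ⋆ X ∣ ≡ n * n * k
    ∣Y⋆X∣≡nnk = *-cancelʳ-≡ _ _ k (begin
      ∣ Y ⋆ X ∣ * k           ≡⟨ cong (∣ Y ⋆ X ∣ *_) (trans (cong ∣_∣ (∩-comm Y X)) ∣X∩Y∣≡k) ⟨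
      ∣ Y ⋆ X ∣ * ∣ Y ∩ X ∣   ≡⟨ ∣X∣*∣Y∣≡∣X⋆Y∣*∣X∩Y∣ Y-sub X-sub ⟨
      ∣ Y ∣ * ∣ X ∣           ≡⟨ cong₂ _*_ ∣Y∣≡nk ∣X∣≡nk ⟩
      n * k * (n * k)         ≡⟨ solve 2 (λ n k → n :* k :* (n :* k) := n :* n :* k :* k) refl n k ⟩
      n * n * k * k           ∎)
      where open ≡-Reasoning

    ∣X⋆D∣+∣W∣≡N : ∣ X ⋆ D ∣ + ∣ W ∣ ≡ N
    ∣X⋆D∣+∣W∣≡N = begin
      ∣ X ⋆ D ∣ + ∣ W ∣       ≡⟨ cong₂ _+_ (sym n*∣D∣≡∣X⋆D∣) ∣W∣≡nnk ⟩
      n * ∣ D ∣ + n * n * k   ≡⟨ solve 3 (λ n d k → n :* d :+ n :* n :* k := n :* (n :* k :+ d)) refl n ∣ D ∣ k ⟩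
      n * (n * k + ∣ D ∣)     ≡⟨ cong (λ x → n * (x + ∣ D ∣)) ∣X∣≡nk ⟨
      n * (∣ X ∣ + ∣ D ∣)     ≡⟨ cong (n *_) (trans (sym ∣Y⋆X∣≡∣X∣+∣D∣) ∣Y⋆X∣≡nnk) ⟩
      n * (n * n * k)         ≡⟨ solve 2 (λ n k → n :* (n :* n :* k) := n :* n :* n :* k) refl n k ⟩
      n * n * n * k           ≡⟨ N≡nnnk ⟨
      N                       ∎
      where open ≡-Reasoning

    X⋆D-disjoint-W : ∀ {h} → h ∈ X ⋆ D → h ∉ W
    X⋆D-disjoint-W h∈XD h∈W with ∈⋆⁻ h∈XD
    ... | x , z , x∈X , z∈D , xz≡h with ∈D⁻ z∈D
    ...   | (y , a , y∈Y , a∈X , ya≡z) , z∉X = z∉X (subst (_∈ X) ya≡z (X.∙∈ (W∩Y⊆X y∈W y∈Y) a∈X))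
      where
      z∈W : z ∈ W
      z∈W = subst (_∈ W) (sym (y≈x\\z x z _ xz≡h)) (W.∙∈ (W.⁻¹∈ (X⊆W x∈X)) h∈W)
      y∈W : y ∈ W
      y∈W = subst (_∈ W) (sym (x≈z//y y a z ya≡z)) (W.∙∈ z∈W (W.⁻¹∈ (X⊆W a∈X)))

    X⋆D∪W-covers : ∀ h → h ∈ X ⋆ D ⊎ h ∈ W
    X⋆D∪W-covers = ∣p∣+∣q∣≡n⇒cover {p = X ⋆ D} {q = W} X⋆D-disjoint-W ∣X⋆D∣+∣W∣≡N

    D⊆Y⋆X : D ⊆ Y ⋆ X
    D⊆Y⋆X z∈D = proj₁ (x∈p∩q⁻ (Y ⋆ X) (∁ X) z∈D)

    ∉W⇒∈X⋆Y⋆X : ∀ {h} → h ∉ W → h ∈ X ⋆ (Y ⋆ X)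
    ∉W⇒∈X⋆Y⋆X {h} h∉W = [ ⋆-monoʳ {X} {D} {Y ⋆ X} D⊆Y⋆X , (λ h∈W → ⊥-elim (h∉W h∈W)) ]′ (X⋆D∪W-covers h)

  -- The incidence structure of cosets

  module Plane {A B AM BM : Subset N}
    (A-sub : IsSubgroup G A) (B-sub : IsSubgroup G B) (AM-sub : IsSubgroup G AM) (BM-sub : IsSubgroup G BM)
    (A⊆AM : A ⊆ AM) (B⊆BM : B ⊆ BM)
    (AM∩B⊆A : ∀ {z} → z ∈ AM → z ∈ B → z ∈ A) (BM∩A⊆B : ∀ {z} → z ∈ BM → z ∈ A → z ∈ B)
    (AB∩BA⊆A∪B : ∀ {z} → z ∈ A ⋆ B → z ∈ B ⋆ A → z ∈ A ⊎ z ∈ B)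
    (A⋆BM-full : ∀ g → g ∈ A ⋆ BM) (B⋆AM-full : ∀ g → g ∈ B ⋆ AM)
    (∉AM⇒∈A⋆B⋆A : ∀ {h} → h ∉ AM → h ∈ A ⋆ (B ⋆ A)) (∉BM⇒∈B⋆A⋆B : ∀ {h} → h ∉ BM → h ∈ B ⋆ (A ⋆ B))
    {b x : Fin N} (b∈B : b ∈ B) (b∉A : b ∉ A) (x∉BM : x ∉ BM)
    where

    module A/ = Cosets A-sub
    module B/ = Cosets B-sub
    module AM/ = Cosets AM-sub
    module BM/ = Cosets BM-sub

    data Point : Set where
      ∞ : Point
      ideal : BM/.Coset → Point
      affine : A/.Coset → Point

    data Line : Set where
      L∞ : Line
      vertical : AM/.Coset → Line
      oblique : B/.Coset → Line

    Meets : Fin N → Fin N → Set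
    Meets r s = ∃ λ x → r A/.∼ x × s B/.∼ x

    Incident : Point → Line → Set
    Incident ∞ L∞ = ⊤
    Incident ∞ (vertical _) = ⊤
    Incident ∞ (oblique _) = ⊥
    Incident (ideal _) L∞ = ⊤
    Incident (ideal _) (vertical _) = ⊥
    Incident (ideal (r , _)) (oblique (s , _)) = r BM/.∼ s
    Incident (affine _) L∞ = ⊥
    Incident (affine (r , _)) (vertical (t , _)) = r AM/.∼ t
    Incident (affine (r , _)) (oblique (s , _)) = Meets r s

    incident? : ∀ p l → Dec (Incident p l)
    incident? ∞ L∞ = yes tt
    incident? ∞ (vertical _) = yes tt
    incident? ∞ (oblique _) = no λ ()
    incident? (ideal _) L∞ = yes tt
    incident? (ideal _) (vertical _) = no λ ()
    incident? (ideal (r , _)) (oblique (s , _)) = r BM/.∼? s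
    incident? (affine _) L∞ = no λ ()
    incident? (affine (r , _)) (vertical (t , _)) = r AM/.∼? t
    incident? (affine (r , _)) (oblique (s , _)) = any? λ x → (r A/.∼? x) ×-dec (s B/.∼? x)

    ideal-affine-line : ∀ r a → ∃ λ l → Incident (ideal r) l × Incident (affine a) l
    ideal-affine-line (r , _) (a , _) with ∈⋆⁻ (A⋆BM-full (a \\ r))
    ... | x , w , x∈A , w∈BM , xw≡a\\r =
      oblique B/.[ a ∙ x ] ,
      BM/.∼-trans r∼ax (B⊆BM (B/.∼-rep (a ∙ x))) ,
      (a ∙ x , A/.∼-∙ a x∈A , B/.∼-sym (B/.∼-rep (a ∙ x)))
      where
      r∼ax : r BM/.∼ a ∙ x
      r∼ax = BM/.∼-sym (subst (_∈ BM) (sym (\\-∙-cancel (sym xw≡a\\r))) w∈BM)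

    affine-affine-line : ∀ a a′ → ∃ λ l → Incident (affine a) l × Incident (affine a′) l
    affine-affine-line (a , _) (a′ , _) with a AM/.∼? a′
    ... | yes a∼a′ = vertical AM/.[ a ] , AM/.∼-rep a , AM/.∼-trans (AM/.∼-sym a∼a′) (AM/.∼-rep a)
    ... | no a≁a′ with ∈⋆⁻ (∉AM⇒∈A⋆B⋆A a≁a′)
    ...   | x , z , x∈A , z∈BA , xz≡a\\a′ with ∈⋆⁻ z∈BA
    ...     | y , x′ , y∈B , x′∈A , yx′≡z =
      oblique B/.[ a ∙ x ] ,
      (a ∙ x , A/.∼-∙ a x∈A , B/.∼-sym (B/.∼-rep (a ∙ x))) ,
      (a ∙ x ∙ y , A/.∼-sym axy∼a′ , B/.∼-trans (B/.∼-sym (B/.∼-rep (a ∙ x))) (B/.∼-∙ (a ∙ x) y∈B))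
      where
      axy∼a′ : a ∙ x ∙ y A/.∼ a′
      axy∼a′ = subst (_∈ A) (sym (\\-∙-cancel (\\-∙-cancel (trans (sym xz≡a\\a′) (cong (x ∙_) (sym yx′≡z)))))) x′∈A

    join : ∀ p q → p ≢ q → ∃ λ l → Incident p l × Incident q l
    join ∞ ∞ p≢q = ⊥-elim (p≢q refl)
    join ∞ (ideal _) _ = L∞ , tt , tt
    join ∞ (affine (a , _)) _ = vertical AM/.[ a ] , tt , AM/.∼-rep a
    join (ideal _) ∞ _ = L∞ , tt , tt
    join (ideal _) (ideal _) _ = L∞ , tt , tt
    join (ideal r) (affine a) _ = ideal-affine-line r a
    join (affine (a , _)) ∞ _ = vertical AM/.[ a ] , AM/.∼-rep a , tt
    join (affine a) (ideal r) _ = map₂ swap (ideal-affine-line r a)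
    join (affine a) (affine a′) _ = affine-affine-line a a′

    vertical-oblique-point : ∀ t s → ∃ λ p → Incident p (vertical t) × Incident p (oblique s)
    vertical-oblique-point (t , _) (s , _) with ∈⋆⁻ (B⋆AM-full (s \\ t))
    ... | y , w , y∈B , w∈AM , yw≡s\\t =
      affine A/.[ s ∙ y ] , AM/.∼-trans (A⊆AM (A/.∼-sym (A/.∼-rep (s ∙ y)))) sy∼t ,
      s ∙ y , A/.∼-sym (A/.∼-rep (s ∙ y)) , B/.∼-∙ s y∈B
      where
      sy∼t : s ∙ y AM/.∼ t
      sy∼t = subst (_∈ AM) (sym (\\-∙-cancel (sym yw≡s\\t))) w∈AM

    oblique-oblique-point : ∀ s s′ → ∃ λ p → Incident p (oblique s) × Incident p (oblique s′)
    oblique-oblique-point (s , _) (s′ , _) with s BM/.∼? s′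
    ... | yes s∼s′ = ideal BM/.[ s ] , BM/.∼-sym (BM/.∼-rep s) , BM/.∼-trans (BM/.∼-sym (BM/.∼-rep s)) s∼s′
    ... | no s≁s′ with ∈⋆⁻ (∉BM⇒∈B⋆A⋆B s≁s′)
    ...   | y , z , y∈B , z∈AB , yz≡s\\s′ with ∈⋆⁻ z∈AB
    ...     | x , y′ , x∈A , y′∈B , xy′≡z =
      affine A/.[ s ∙ y ] ,
      (s ∙ y , A/.∼-sym (A/.∼-rep (s ∙ y)) , B/.∼-∙ s y∈B) ,
      (s ∙ y ∙ x , A/.∼-trans (A/.∼-sym (A/.∼-rep (s ∙ y))) (A/.∼-∙ (s ∙ y) x∈A) , B/.∼-sym syx∼s′)
      where
      syx∼s′ : s ∙ y ∙ x B/.∼ s′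
      syx∼s′ = subst (_∈ B) (sym (\\-∙-cancel (\\-∙-cancel (trans (sym yz≡s\\s′) (cong (y ∙_) (sym xy′≡z)))))) y′∈B

    meet : ∀ l m → l ≢ m → ∃ λ p → Incident p l × Incident p m
    meet L∞ L∞ l≢m = ⊥-elim (l≢m refl)
    meet L∞ (vertical _) _ = ∞ , tt , tt
    meet L∞ (oblique (s , _)) _ = ideal BM/.[ s ] , tt , BM/.∼-sym (BM/.∼-rep s)
    meet (vertical _) L∞ _ = ∞ , tt , tt
    meet (vertical _) (vertical _) _ = ∞ , tt , tt
    meet (vertical t) (oblique s) _ = vertical-oblique-point t s
    meet (oblique (s , _)) L∞ _ = ideal BM/.[ s ] , BM/.∼-sym (BM/.∼-rep s) , tt
    meet (oblique s) (vertical t) _ = map₂ swap (vertical-oblique-point t s)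
    meet (oblique s) (oblique s′) _ = oblique-oblique-point s s′

    L∞∩vertical : ∀ p {t} → Incident p L∞ → Incident p (vertical t) → p ≡ ∞
    L∞∩vertical ∞ _ _ = refl

    L∞∩oblique : ∀ p {s} → Incident p L∞ → Incident p (oblique s) → p ≡ ideal BM/.[ proj₁ s ]
    L∞∩oblique (ideal r) _ r∼s = cong ideal (sym (BM/.∼-repr r (BM/.∼-sym r∼s)))

    vertical∩vertical : ∀ p {t t′} → vertical t ≢ vertical t′ →
                        Incident p (vertical t) → Incident p (vertical t′) → p ≡ ∞
    vertical∩vertical ∞ _ _ _ = refl
    vertical∩vertical (affine _) {t} {t′} t≢t′ r∼t r∼t′ =
      ⊥-elim (t≢t′ (cong vertical (AM/.∼⇒≡ t t′ (AM/.∼-trans (AM/.∼-sym r∼t) r∼t′))))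

    vertical∩oblique : ∀ {p q t s} → Incident p (vertical t) → Incident p (oblique s) →
                       Incident q (vertical t) → Incident q (oblique s) → p ≡ q
    vertical∩oblique {affine r} {affine r′} r∼t (x , r∼x , s∼x) r′∼t (y , r′∼y , s∼y) =
      cong affine (A/.∼⇒≡ r r′ (A/.∼-resp (A/.∼-sym r∼x) (A/.∼-sym r′∼y) x∼y))
      where
      x∼y : x A/.∼ y
      x∼y = AM∩B⊆A (AM/.∼-resp (A⊆AM r∼x) (A⊆AM r′∼y) (AM/.∼-trans r∼t (AM/.∼-sym r′∼t)))
                   (B/.∼-resp s∼x s∼y B/.∼-refl)

    ideal-affine-oblique-unique : ∀ {r a s s′} → Incident (ideal r) (oblique s) → Incident (ideal r) (oblique s′) →
                                  Incident (affine a) (oblique s) → Incident (affine a) (oblique s′) → s ≡ s′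
    ideal-affine-oblique-unique {s = s} {s′} r∼s r∼s′ (x , a∼x , s∼x) (y , a∼y , s′∼y) =
      B/.∼⇒≡ s s′ (B/.∼-resp (B/.∼-sym s∼x) (B/.∼-sym s′∼y) x∼y)
      where
      x∼y : x B/.∼ y
      x∼y = BM∩A⊆B (BM/.∼-resp (B⊆BM s∼x) (B⊆BM s′∼y) (BM/.∼-trans (BM/.∼-sym r∼s) r∼s′))
                   (A/.∼-resp a∼x a∼y A/.∼-refl)

    affine-oblique-unique : ∀ {a a′ s s′} → s ≢ s′ →
                            Incident (affine a) (oblique s) → Incident (affine a) (oblique s′) →
                            Incident (affine a′) (oblique s) → Incident (affine a′) (oblique s′) → a ≡ a′
    affine-oblique-unique {a} {a′} {s} {s′} s≢s′ (x , a∼x , s∼x) (y , a∼y , s′∼y) (u , a′∼u , s∼u) (v , a′∼v , s′∼v) =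
      A/.∼⇒≡ a a′ (x∼v⇒a∼a′ (AB∩BA⊆A∪B x\\v∈AB x\\v∈BA))
      where
      x\\v∈AB : x \\ v ∈ A ⋆ B
      x\\v∈AB = subst (_∈ A ⋆ B) (\\-trans x y v) (∈⋆⁺ (A/.∼-resp a∼x a∼y A/.∼-refl) (B/.∼-resp s′∼y s′∼v B/.∼-refl))
      x\\v∈BA : x \\ v ∈ B ⋆ A
      x\\v∈BA = subst (_∈ B ⋆ A) (\\-trans x u v) (∈⋆⁺ (B/.∼-resp s∼x s∼u B/.∼-refl) (A/.∼-resp a′∼u a′∼v A/.∼-refl))
      x∼v⇒a∼a′ : x A/.∼ v ⊎ x B/.∼ v → proj₁ a A/.∼ proj₁ a′
      x∼v⇒a∼a′ (inj₁ x∼v) = A/.∼-resp (A/.∼-sym a∼x) (A/.∼-sym a′∼v) x∼v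
      x∼v⇒a∼a′ (inj₂ x∼v) = ⊥-elim (s≢s′ (B/.∼⇒≡ s s′ (B/.∼-resp (B/.∼-sym s∼x) (B/.∼-sym s′∼v) x∼v)))

    oblique∩oblique : ∀ {p q s s′} → oblique s ≢ oblique s′ → Incident p (oblique s) → Incident p (oblique s′) →
                      Incident q (oblique s) → Incident q (oblique s′) → p ≡ q
    oblique∩oblique {ideal r} {ideal r′} _ r∼s _ r′∼s _ = cong ideal (BM/.∼⇒≡ r r′ (BM/.∼-trans r∼s (BM/.∼-sym r′∼s)))
    oblique∩oblique {ideal r} {affine a} {s} {s′} s≢s′ r-on-s r-on-s′ a-on-s a-on-s′ =
      ⊥-elim (s≢s′ (cong oblique (ideal-affine-oblique-unique {r} {a} {s} {s′} r-on-s r-on-s′ a-on-s a-on-s′)))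
    oblique∩oblique {affine a} {ideal r} {s} {s′} s≢s′ a-on-s a-on-s′ r-on-s r-on-s′ =
      ⊥-elim (s≢s′ (cong oblique (ideal-affine-oblique-unique {r} {a} {s} {s′} r-on-s r-on-s′ a-on-s a-on-s′)))
    oblique∩oblique {affine _} {affine _} s≢s′ a-on-s a-on-s′ a′-on-s a′-on-s′ =
      cong affine (affine-oblique-unique (λ s≡s′ → s≢s′ (cong oblique s≡s′)) a-on-s a-on-s′ a′-on-s a′-on-s′)

    meet-unique : ∀ {l m p q} → l ≢ m → Incident p l → Incident p m → Incident q l → Incident q m → p ≡ q
    meet-unique {L∞} {L∞} l≢m _ _ _ _ = ⊥-elim (l≢m refl)
    meet-unique {L∞} {vertical _} {p} {q} _ pl pm ql qm = trans (L∞∩vertical p pl pm) (sym (L∞∩vertical q ql qm))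
    meet-unique {L∞} {oblique _} {p} {q} _ pl pm ql qm = trans (L∞∩oblique p pl pm) (sym (L∞∩oblique q ql qm))
    meet-unique {vertical _} {L∞} {p} {q} _ pl pm ql qm = trans (L∞∩vertical p pm pl) (sym (L∞∩vertical q qm ql))
    meet-unique {vertical _} {vertical _} {p} {q} l≢m pl pm ql qm =
      trans (vertical∩vertical p l≢m pl pm) (sym (vertical∩vertical q l≢m ql qm))
    meet-unique {vertical t} {oblique s} {p} {q} _ pl pm ql qm = vertical∩oblique {p} {q} {t} {s} pl pm ql qm
    meet-unique {oblique _} {L∞} {p} {q} _ pl pm ql qm = trans (L∞∩oblique p pm pl) (sym (L∞∩oblique q qm ql))
    meet-unique {oblique s} {vertical t} {p} {q} _ pl pm ql qm = vertical∩oblique {p} {q} {t} {s} pm pl qm ql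
    meet-unique {oblique s} {oblique s′} {p} {q} l≢m pl pm ql qm = oblique∩oblique {p} {q} {s} {s′} l≢m pl pm ql qm

    _≟ᴸ_ : (l m : Line) → Dec (l ≡ m)
    L∞ ≟ᴸ L∞ = yes refl
    L∞ ≟ᴸ vertical _ = no λ ()
    L∞ ≟ᴸ oblique _ = no λ ()
    vertical _ ≟ᴸ L∞ = no λ ()
    vertical t ≟ᴸ vertical t′ = map′ (cong vertical) (λ { refl → refl }) (t AM/.≟ t′)
    vertical _ ≟ᴸ oblique _ = no λ ()
    oblique _ ≟ᴸ L∞ = no λ ()
    oblique _ ≟ᴸ vertical _ = no λ ()
    oblique s ≟ᴸ oblique s′ = map′ (cong oblique) (λ { refl → refl }) (s B/.≟ s′)

    join-unique : ∀ {p q l m} → p ≢ q → Incident p l → Incident q l → Incident p m → Incident q m → l ≡ m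
    join-unique {l = l} {m} p≢q pl ql pm qm with l ≟ᴸ m
    ... | yes l≡m = l≡m
    ... | no l≢m = ⊥-elim (p≢q (meet-unique l≢m pl pm ql qm))

    _I_ : Point → Line → Bool
    p I l = does (incident? p l)

    on : ∀ {p l} → Incident p l → p I l ≡ true
    on {p} {l} = dec-true (incident? p l)

    incident : ∀ {p l} → p I l ≡ true → Incident p l
    incident {p} {l} = from-does (incident? p l)

    no-line-through-∞-ideal-affine : ∀ {r a} l → ¬ (Incident ∞ l × Incident (ideal r) l × Incident (affine a) l)
    no-line-through-∞-ideal-affine L∞ (_ , _ , ())
    no-line-through-∞-ideal-affine (vertical _) (_ , () , _)
    no-line-through-∞-ideal-affine (oblique _) (() , _ , _)

    module Quadrangle where
      o o′ i : Point
      o = affine A/.[ ε ]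
      o′ = affine A/.[ b ]
      i = ideal BM/.[ x ]

      o≢o′ : o ≢ o′
      o≢o′ o≡o′ = b∉A (A/.ε∼⇒∈ (A/.≡⇒∼ (affine-injective o≡o′)))
        where
        affine-injective : ∀ {p q} → affine p ≡ affine q → p ≡ q
        affine-injective refl = refl

      o,o′-on-oblique-ε : Incident o (oblique B/.[ ε ]) × Incident o′ (oblique B/.[ ε ])
      o,o′-on-oblique-ε = (ε , A/.∼-sym (A/.∼-rep ε) , B/.∼-sym (B/.∼-rep ε)) ,
                          (b , A/.∼-sym (A/.∼-rep b) , B/.∼-trans (B/.∼-sym (B/.∼-rep ε)) (B/.∈⇒ε∼ b∈B))

      no-line-through-∞-o-o′ : ∀ l → ¬ (Incident ∞ l × Incident o l × Incident o′ l)
      no-line-through-∞-o-o′ (vertical (t , _)) (_ , ε∼t , b∼t) =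
        b∉A (AM∩B⊆A (AM/.ε∼⇒∈ (AM/.∼-resp (A⊆AM (A/.∼-sym (A/.∼-rep ε))) (A⊆AM (A/.∼-sym (A/.∼-rep b)))
                                            (AM/.∼-trans ε∼t (AM/.∼-sym b∼t))))
                    b∈B)

      no-line-through-i-o-o′ : ∀ l → ¬ (Incident i l × Incident o l × Incident o′ l)
      no-line-through-i-o-o′ (oblique s) (i-on , o-on , o′-on) = x∉BM (BM/.ε∼⇒∈ (BM/.∼-sym x∼ε))
        where
        s≡ε : oblique s ≡ oblique B/.[ ε ]
        s≡ε = join-unique o≢o′ o-on o′-on (proj₁ o,o′-on-oblique-ε) (proj₂ o,o′-on-oblique-ε)
        x∼ε : x BM/.∼ ε
        x∼ε = BM/.∼-resp (BM/.∼-sym (BM/.∼-rep x)) (B⊆BM (B/.∼-sym (B/.∼-rep ε)))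
                (subst (Incident i) s≡ε i-on)

    plane : ProjectivePlane
    plane = record
      { Point = Point
      ; Line = Line
      ; _I_ = _I_
      ; join = λ p q p≢q → let (l , pl , ql) = join p q p≢q in l , on pl , on ql
      ; join-uniq = λ p q l m p≢q pl ql pm qm →
          join-unique p≢q (incident pl) (incident ql) (incident pm) (incident qm)
      ; meet = λ l m l≢m → let (p , pl , pm) = meet l m l≢m in p , on pl , on pm
      ; meet-uniq = λ l m p q l≢m pl pm ql qm →
          meet-unique l≢m (incident pl) (incident pm) (incident ql) (incident qm)
      ; quadrangle = (∞ , i , o , o′) ,
          (λ ()) , (λ ()) , (λ ()) , (λ ()) , (λ ()) , o≢o′ ,
          (λ l (∞l , il , ol) → no-line-through-∞-ideal-affine l (incident ∞l , incident il , incident ol)) ,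
          (λ l (∞l , il , o′l) → no-line-through-∞-ideal-affine l (incident ∞l , incident il , incident o′l)) ,
          (λ l (∞l , ol , o′l) → no-line-through-∞-o-o′ l (incident ∞l , incident ol , incident o′l)) ,
          (λ l (il , ol , o′l) → no-line-through-i-o-o′ l (incident il , incident ol , incident o′l))
      }
      where open Quadrangle

    points-on-L∞ : (Σ Point λ p → p I L∞ ≡ true) ↔ Fin (suc BM/.index)
    points-on-L∞ = mk↔ₛ′ to from to∘from from∘to
      where
      module I = Inverse BM/.Coset↔Fin-index
      to : (Σ Point λ p → p I L∞ ≡ true) → Fin (suc BM/.index)
      to (∞ , _) = zero
      to (ideal r , _) = suc (I.to r)
      from : Fin (suc BM/.index) → Σ Point λ p → p I L∞ ≡ true
      from zero = ∞ , refl
      from (suc j) = ideal (I.from j) , refl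
      to∘from : ∀ j → to (from j) ≡ j
      to∘from zero = refl
      to∘from (suc j) = cong suc (I.strictlyInverseˡ j)
      from∘to : ∀ p → from (to p) ≡ p
      from∘to (∞ , refl) = refl
      from∘to (ideal r , refl) = cong (λ r → ideal r , refl) (I.strictlyInverseʳ r)

    point-action : Fin N → Point → Point
    point-action _ ∞ = ∞
    point-action g (ideal r) = ideal (g BM/.⊙ r)
    point-action g (affine a) = affine (g A/.⊙ a)

    line-action : Fin N → Line → Line
    line-action _ L∞ = L∞
    line-action g (vertical t) = vertical (g AM/.⊙ t)
    line-action g (oblique s) = oblique (g B/.⊙ s)

    Meets-translate : ∀ g {r s r′ s′} → g ∙ r A/.∼ r′ → g ∙ s B/.∼ s′ → Meets r s → Meets r′ s′
    Meets-translate g gr∼r′ gs∼s′ (x , r∼x , s∼x) =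
      g ∙ x , A/.∼-resp gr∼r′ A/.∼-refl (A/.∙-∼ g r∼x) , B/.∼-resp gs∼s′ B/.∼-refl (B/.∙-∼ g s∼x)

    incident-translate : ∀ g p l → Incident p l → Incident (point-action g p) (line-action g l)
    incident-translate g ∞ L∞ _ = tt
    incident-translate g ∞ (vertical _) _ = tt
    incident-translate g (ideal _) L∞ _ = tt
    incident-translate g (ideal r) (oblique s) r∼s = BM/.∼-resp (BM/.∼-⊙ g r) (B⊆BM (B/.∼-⊙ g s)) (BM/.∙-∼ g r∼s)
    incident-translate g (affine a) (vertical t) a∼t = AM/.∼-resp (A⊆AM (A/.∼-⊙ g a)) (AM/.∼-⊙ g t) (AM/.∙-∼ g a∼t)
    incident-translate g (affine a) (oblique s) a⋈s = Meets-translate g (A/.∼-⊙ g a) (B/.∼-⊙ g s) a⋈s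

    point-action-ε : ∀ p → point-action ε p ≡ p
    point-action-ε ∞ = refl
    point-action-ε (ideal r) = cong ideal (BM/.ε-⊙ r)
    point-action-ε (affine a) = cong affine (A/.ε-⊙ a)

    line-action-ε : ∀ l → line-action ε l ≡ l
    line-action-ε L∞ = refl
    line-action-ε (vertical t) = cong vertical (AM/.ε-⊙ t)
    line-action-ε (oblique s) = cong oblique (B/.ε-⊙ s)

    point-action-∙ : ∀ g h p → point-action (g ∙ h) p ≡ point-action g (point-action h p)
    point-action-∙ _ _ ∞ = refl
    point-action-∙ g h (ideal r) = cong ideal (BM/.∙-⊙ g h r)
    point-action-∙ g h (affine a) = cong affine (A/.∙-⊙ g h a)

    line-action-∙ : ∀ g h l → line-action (g ∙ h) l ≡ line-action g (line-action h l)
    line-action-∙ _ _ L∞ = refl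
    line-action-∙ g h (vertical t) = cong vertical (AM/.∙-⊙ g h t)
    line-action-∙ g h (oblique s) = cong oblique (B/.∙-⊙ g h s)

    incident-untranslate : ∀ g p l → Incident (point-action g p) (line-action g l) → Incident p l
    incident-untranslate g p l gp-on-gl =
      subst₂ Incident (action-⁻¹ point-action point-action-ε point-action-∙ g p)
                      (action-⁻¹ line-action line-action-ε line-action-∙ g l)
        (incident-translate (g ⁻¹) (point-action g p) (line-action g l) gp-on-gl)

    action : CollineationAction G plane
    action = record
      { pt = point-action
      ; ln = line-action
      ; pt-ε = point-action-ε
      ; ln-ε = line-action-ε
      ; pt-∙ = point-action-∙
      ; ln-∙ = line-action-∙
      ; inc = λ g p l →
          does-⇔ (mk⇔ (incident-untranslate g p l) (incident-translate g p l)) (incident? _ _) (incident? p l)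
      }

    soft : IsSoftAction action
    soft = (∞ , L∞) , refl , (λ _ → refl) , (λ _ → refl) , flag-transitive
      where
      flag-transitive : ∀ w W w′ W′ → w I W ≡ true → ¬ w I L∞ ≡ true → ¬ ∞ I W ≡ true →
                        w′ I W′ ≡ true → ¬ w′ I L∞ ≡ true → ¬ ∞ I W′ ≡ true →
                        ∃ λ g → point-action g w ≡ w′ × line-action g W ≡ W′
      flag-transitive ∞ _ _ _ _ w∉L∞ _ _ _ _ = ⊥-elim (w∉L∞ refl)
      flag-transitive (ideal _) _ _ _ _ w∉L∞ _ _ _ _ = ⊥-elim (w∉L∞ refl)
      flag-transitive (affine _) L∞ _ _ _ _ ∞∉W _ _ _ = ⊥-elim (∞∉W refl)
      flag-transitive (affine _) (vertical _) _ _ _ _ ∞∉W _ _ _ = ⊥-elim (∞∉W refl)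
      flag-transitive (affine _) (oblique _) ∞ _ _ _ _ _ w′∉L∞ _ = ⊥-elim (w′∉L∞ refl)
      flag-transitive (affine _) (oblique _) (ideal _) _ _ _ _ _ w′∉L∞ _ = ⊥-elim (w′∉L∞ refl)
      flag-transitive (affine _) (oblique _) (affine _) L∞ _ _ _ _ _ ∞∉W′ = ⊥-elim (∞∉W′ refl)
      flag-transitive (affine _) (oblique _) (affine _) (vertical _) _ _ _ _ _ ∞∉W′ = ⊥-elim (∞∉W′ refl)
      flag-transitive (affine a) (oblique s) (affine a′) (oblique s′) a-on-s _ _ a′-on-s′ _ _ =
        let (x , a∼x , s∼x) = incident {affine a} {oblique s} a-on-s
            (x′ , a′∼x′ , s′∼x′) = incident {affine a′} {oblique s′} a′-on-s′
        in x′ // x , cong affine (A/.∼-repr a′ (A/.//-∙-∼ a∼x a′∼x′)) ,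
                     cong oblique (B/.∼-repr s′ (B/.//-∙-∼ s∼x s′∼x′))

-- The configuration of the theorem

module SoftPlane (n N : ℕ) (1<n : 1 < n) (G : FiniteGroup N) (A B M : Subset N)
  (A-sub : IsSubgroup G A) (B-sub : IsSubgroup G B) (M-sub : IsSubgroup G M)
  (∣A∣≡nk : ∣ A ∣ ≡ n * ∣ A ∩ B ∣) (∣B∣≡nk : ∣ B ∣ ≡ n * ∣ A ∩ B ∣)
  (N≡nnnk : N ≡ n * n * n * ∣ A ∩ B ∣)
  (AM-sub : IsSubgroup G (_·_ G A M)) (∣AM∣≡nnk : ∣ _·_ G A M ∣ ≡ n * n * ∣ A ∩ B ∣)
  (BM-sub : IsSubgroup G (_·_ G B M)) (∣BM∣≡nnk : ∣ _·_ G B M ∣ ≡ n * n * ∣ A ∩ B ∣)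
  (G≡AMB : ∀ (g : Fin N) → g ∈ _·_ G (_·_ G A M) B)
  (AB∩BA≡A∪B : _·_ G A B ∩ _·_ G B A ≡ A ∪ B) where

  open GroupTheory G
  private
    module A = IsSubgroup A-sub
    module B = IsSubgroup B-sub
    module M = IsSubgroup M-sub
    module BM = IsSubgroup BM-sub

  k : ℕ
  k = ∣ A ∩ B ∣

  private
    instance
      k-nonZero : NonZero k
      k-nonZero = ∈⇒∣p∣-nonZero (x∈p∩q⁺ (A.ε∈ , B.ε∈))
      nnk-nonZero : NonZero (n * n * k)
      nnk-nonZero = subst NonZero ∣BM∣≡nnk (∈⇒∣p∣-nonZero BM.ε∈)

  ⊆-⋆M : ∀ {X} → X ⊆ X ⋆ M
  ⊆-⋆M {_} {x} x∈X = subst (_∈ _ ⋆ M) (identityʳ x) (∈⋆⁺ x∈X M.ε∈)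

  M⋆B⊆B⋆M : ∀ {m b} → m ∈ M → b ∈ B → m ∙ b ∈ B ⋆ M
  M⋆B⊆B⋆M {m} {b} m∈M b∈B =
    subst (_∈ B ⋆ M) (trans (⁻¹-anti-homo-∙ (b ⁻¹) (m ⁻¹)) (cong₂ _∙_ (⁻¹-involutive m) (⁻¹-involutive b)))
          (BM.⁻¹∈ (∈⋆⁺ (B.⁻¹∈ b∈B) (M.⁻¹∈ m∈M)))

  A⋆BM-full : ∀ g → g ∈ A ⋆ (B ⋆ M)
  A⋆BM-full g =
    let (x , b , x∈AM , b∈B , xb≡g) = ∈⋆⁻ (G≡AMB g)
        (a , m , a∈A , m∈M , am≡x) = ∈⋆⁻ x∈AM
    in subst (_∈ A ⋆ (B ⋆ M)) (trans (sym (assoc a m b)) (trans (cong (_∙ b) am≡x) xb≡g)) (∈⋆⁺ a∈A (M⋆B⊆B⋆M m∈M b∈B))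

  AM∩B⊆A : ∀ {z} → z ∈ A ⋆ M → z ∈ B → z ∈ A
  AM∩B⊆A = ⋆-full⇒∩⊆ AM-sub B-sub ⊆-⋆M G≡AMB (begin
    ∣ A ⋆ M ∣ * ∣ B ∣     ≡⟨ cong₂ _*_ ∣AM∣≡nnk ∣B∣≡nk ⟩
    n * n * k * (n * k)   ≡⟨ solve 2 (λ n k → n :* n :* k :* (n :* k) := n :* n :* n :* k :* k) refl n k ⟩
    n * n * n * k * k     ≡⟨ cong (_* k) N≡nnnk ⟨
    N * k                 ∎)
    where open ≡-Reasoning

  BM∩A⊆B : ∀ {z} → z ∈ B ⋆ M → z ∈ A → z ∈ B
  BM∩A⊆B = ⋆-full⇒∩⊆ BM-sub A-sub ⊆-⋆M (⋆-full-swap A-sub BM-sub A⋆BM-full) (begin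
    ∣ B ⋆ M ∣ * ∣ A ∣     ≡⟨ cong₂ _*_ ∣BM∣≡nnk ∣A∣≡nk ⟩
    n * n * k * (n * k)   ≡⟨ solve 2 (λ n k → n :* n :* k :* (n :* k) := n :* n :* n :* k :* k) refl n k ⟩
    n * n * n * k * k     ≡⟨ cong₂ _*_ N≡nnnk (cong ∣_∣ (∩-comm B A)) ⟨
    N * ∣ B ∩ A ∣         ∎)
    where open ≡-Reasoning

  AB∩BA⊆A∪B : ∀ {z} → z ∈ A ⋆ B → z ∈ B ⋆ A → z ∈ A ⊎ z ∈ B
  AB∩BA⊆A∪B {z} z∈AB z∈BA = x∈p∪q⁻ A B (subst (z ∈_) AB∩BA≡A∪B (x∈p∩q⁺ (z∈AB , z∈BA)))

  BA∩AB⊆B∪A : ∀ {z} → z ∈ B ⋆ A → z ∈ A ⋆ B → z ∈ B ⊎ z ∈ A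
  BA∩AB⊆B∪A z∈BA z∈AB = [ inj₂ , inj₁ ]′ (AB∩BA⊆A∪B z∈AB z∈BA)

  open Covering A-sub B-sub AM-sub ⊆-⋆M AM∩B⊆A AB∩BA⊆A∪B {n} {k} ∣A∣≡nk ∣B∣≡nk refl ∣AM∣≡nnk N≡nnnk
    using () renaming (∉W⇒∈X⋆Y⋆X to ∉AM⇒∈A⋆B⋆A)
  open Covering B-sub A-sub BM-sub ⊆-⋆M BM∩A⊆B BA∩AB⊆B∪A {n} {k} ∣B∣≡nk ∣A∣≡nk (cong ∣_∣ (∩-comm B A)) ∣BM∣≡nnk N≡nnnk
    using () renaming (∉W⇒∈X⋆Y⋆X to ∉BM⇒∈B⋆A⋆B)

  B⊈A : ∃ λ b → b ∈ B × b ∉ A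
  B⊈A = decidable-stable (any? λ b → (b ∈? B) ×-dec ¬? (b ∈? A)) λ B⊆A →
    <⇒≱ (m<m*n k n 1<n) (subst₂ _≤_ (trans ∣B∣≡nk (*-comm n k)) refl (p⊆q⇒∣p∣≤∣q∣ (B⊆A∩B B⊆A)))
    where
    B⊆A∩B : ¬ (∃ λ b → b ∈ B × b ∉ A) → B ⊆ A ∩ B
    B⊆A∩B B⊆A b∈B = x∈p∩q⁺ (decidable-stable (_ ∈? A) (λ b∉A → B⊆A (_ , b∈B , b∉A)) , b∈B)

  BM≢G : ∃ λ x → x ∉ B ⋆ M
  BM≢G = ¬∀⟶∃¬ N (_∈ B ⋆ M) (_∈? B ⋆ M) λ BM-full → <⇒≢ (m<m*n (n * n * k) n 1<n) (begin
    n * n * k       ≡⟨ ∣BM∣≡nnk ⟨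
    ∣ B ⋆ M ∣       ≡⟨ ∀∈⇒∣p∣≡n BM-full ⟩
    N               ≡⟨ N≡nnnk ⟩
    n * n * n * k   ≡⟨ solve 2 (λ n k → n :* n :* n :* k := n :* n :* k :* n) refl n k ⟩
    n * n * k * n   ∎)
    where open ≡-Reasoning

  open Plane A-sub B-sub AM-sub BM-sub ⊆-⋆M ⊆-⋆M AM∩B⊆A BM∩A⊆B AB∩BA⊆A∪B
    A⋆BM-full (⋆-full-swap AM-sub B-sub G≡AMB) ∉AM⇒∈A⋆B⋆A ∉BM⇒∈B⋆A⋆B
    (proj₁ (proj₂ B⊈A)) (proj₂ (proj₂ B⊈A)) (proj₂ BM≢G) public

  index≡n : BM/.index ≡ n
  index≡n = *-cancelʳ-≡ _ _ (n * n * k) (begin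
    BM/.index * (n * n * k)   ≡⟨ cong (BM/.index *_) ∣BM∣≡nnk ⟨
    BM/.index * ∣ B ⋆ M ∣     ≡⟨ BM/.index*∣H∣≡N ⟩
    N                         ≡⟨ N≡nnnk ⟩
    n * n * n * k             ≡⟨ solve 2 (λ n k → n :* n :* n :* k := n :* (n :* n :* k)) refl n k ⟩
    n * (n * n * k)           ∎)
    where open ≡-Reasoning

  order : HasOrder plane n
  order = L∞ , subst (λ m → (Σ Point λ p → p I L∞ ≡ true) ↔ Fin (suc m)) index≡n points-on-L∞

theorem2p1 : (n N : ℕ) → 1 < n → (G : FiniteGroup N) → (A B M : Subset N) →
    IsSubgroup G A → IsSubgroup G B → IsSubgroup G M →
    ∣ A ∣ ≡ n * ∣ A ∩ B ∣ → ∣ B ∣ ≡ n * ∣ A ∩ B ∣ → ∣ M ∣ ≡ n * ∣ A ∩ B ∣ →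
    N ≡ n * n * n * ∣ A ∩ B ∣ →
    IsSubgroup G (_·_ G A M) → ∣ _·_ G A M ∣ ≡ n * n * ∣ A ∩ B ∣ →
    IsSubgroup G (_·_ G B M) → ∣ _·_ G B M ∣ ≡ n * n * ∣ A ∩ B ∣ →
    (∀ (g : Fin N) → g ∈ _·_ G (_·_ G A M) B) →
    (_·_ G A B ∩ _·_ G B A ≡ A ∪ B) →
    Σ ProjectivePlane λ π → HasOrder π n ×
      Σ (CollineationAction G π) λ act → IsSoftAction act
theorem2p1 n N 1<n G A B M A-sub B-sub M-sub ∣A∣≡nk ∣B∣≡nk _ N≡nnnk AM-sub ∣AM∣≡nnk BM-sub ∣BM∣≡nnk G≡AMB AB∩BA≡A∪B =
  plane , order , action , soft
  where
  open SoftPlane n N 1<n G A B M A-sub B-sub M-sub ∣A∣≡nk ∣B∣≡nk N≡nnnk AM-sub ∣AM∣≡nnk BM-sub ∣BM∣≡nnk G≡AMB AB∩BA≡A∪B
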